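{- Let $d,k\ge1$ be integers, let $G$ be a graph without isolated vertices with $d\text{ - }pw(G)\ge k$, and let $Z$ be a $d$-SMNBP with yardsticks representing $\psi(G)$. Let $P$ be a source-sink path of $Z$ and let $u_1,\dots,u_{a+1}$ ($a\le d$) be yardsticks of $P$. Then there is $1\le i\le a$ such that $G(u_i,u_{i+1})$ has pathwidth at least $k$.
   Context: $\psi(G)$ is the CNF with variable set $V(G)\cup E(G)$ and, for each edge $e=\{u,v\}$, the clause $(u\vee e\vee v)$. The $d$-pathwidth $d\text{ - }pw(G)$ is the smallest $k$ such that there are subgraphs $G_1,\dots,G_d$ of $G$, each of pathwidth at most $k$, with $G=G_1\cup\dots\cup G_d$. A nondeterministic branching program (NBP) $Z$ is a directed acyclic graph, multiple edges allowed, with one source and one sink, some of whose edges are labelled with literals; $A(P)$ denotes the set of labels of a path $P$. A satisfying assignment of $Z$ is an assignment $S$ to the variables labelling $Z$ such that some consistent (no variable with its negation) source-sink path $P$ has $A(P)\subseteq S$; $Z$ represents $\psi(G)$ if its satisfying assignments are exactly those of $\psi(G)$. $Z$ is monotone if no edge is labelled with a negative literal. A path is read-once if no two of its edges are labelled with the same variable. A $d$-SMNBP is a monotone NBP in which along every path each variable labels at most $d$ edges, and every source-sink path can be partitioned into at most $d$ edge-disjoint consecutive read-once subpaths. $Z$ has yardsticks if every source-sink path $P$ contains vertices $u_1,\dots,u_{a+1}$, $a\le d$, in this order on $P$, with $u_1$ the source and $u_{a+1}$ the sink, such that for every $i\le a$ every path of $Z$ from $u_i$ to $u_{i+1}$ is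 read-once; such $u_1,\dots,u_{a+1}$ are called yardsticks of $P$. For vertices $x,y$ of $Z$ such that $Z$ has a path from $x$ to $y$: $\psi(x,y)$ is the set of clauses $C$ of $\psi(G)$ such that $A(P)\cap C\ne\emptyset$ for every path $P$ of $Z$ from $x$ to $y$; $G(x,y)$ is the subgraph of $G$ formed by the edges corresponding to the clauses of $\psi(x,y)$ (with their endpoints). -}

module Defs where

open import Data.Nat using (ℕ; zero; suc; _≤_)
import Data.Fin
open import Data.Fin using (Fin; inject₁; fromℕ) renaming (_≤_ to _≤ᶠ_)
open import Data.Fin.Properties using () renaming (_≟_ to _≟ᶠ_)
open import Data.Fin.Subset using (Subset; _∈_; ∣_∣)
open import Data.Product using (Σ; ∃; ∃-syntax; _×_; _,_; proj₁; proj₂; swap)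
open import Data.Sum using (_⊎_; inj₁; inj₂)
open import Data.Sum.Properties using (≡-dec)
open import Data.Maybe using (Maybe; just; nothing)
import Data.Maybe as Maybe
open import Data.List using (List; []; _∷_; mapMaybe; concat; tabulate; length; filter)
open import Data.List.Relation.Unary.Unique.Propositional using (Unique)
open import Data.List.Relation.Unary.Any using (Any)
open import Data.List.Relation.Unary.All using (All)
open import Data.Empty using (⊥)
open import Relation.Nullary using (¬_)
open import Relation.Binary.PropositionalEquality using (_≡_; _≢_)
open import Relation.Binary.Definitions using (DecidableEquality)

record Graph : Set where
  field
    n : ℕ
    m : ℕ
    ends     : Fin m → Fin n × Fin n
    loopless : ∀ e → proj₁ (ends e) ≢ proj₂ (ends e)
    simple   : ∀ e f → (ends e ≡ ends f) ⊎ (ends e ≡ swap (ends f)) → e ≡ f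

module _ (G : Graph) where
  open Graph G

  IsEnd : Fin n → Fin m → Set
  IsEnd v e = (v ≡ proj₁ (ends e)) ⊎ (v ≡ proj₂ (ends e))

  NoIsolatedVertices : Set
  NoIsolatedVertices = ∀ v → ∃[ e ] IsEnd v e

  record Subgraph : Set₁ where
    field
      V : Fin n → Set
      E : Fin m → Set
      closed : ∀ e v → E e → IsEnd v e → V v

  record PathDecomposition (H : Subgraph) (w : ℕ) : Set where
    field
      r : ℕ
      B : Fin r → Subset n
      bags⊆V   : ∀ i v → v ∈ B i → Subgraph.V H v
      vcover   : ∀ v → Subgraph.V H v → ∃[ i ] (v ∈ B i)
      ecover   : ∀ e → Subgraph.E H e →
                 ∃[ i ] (proj₁ (ends e) ∈ B i × proj₂ (ends e) ∈ B i)
      interval : ∀ v i j l → i ≤ᶠ j → j ≤ᶠ l → v ∈ B i → v ∈ B l → v ∈ B j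
      width    : ∀ i → ∣ B i ∣ ≤ suc w

  PwAtMost : Subgraph → ℕ → Set
  PwAtMost H w = PathDecomposition H w

  PwAtLeast : Subgraph → ℕ → Set
  PwAtLeast H k = ∀ w → PwAtMost H w → k ≤ w

  DPwAtLeast : ℕ → ℕ → Set₁
  DPwAtLeast d k =
    ∀ w (Gs : Fin d → Subgraph) →
      (∀ i → PwAtMost (Gs i) w) →
      (∀ v → ∃[ i ] Subgraph.V (Gs i) v) →
      (∀ e → ∃[ i ] Subgraph.E (Gs i) e) →
      k ≤ w

  -- Variables of ψ(G): vertices and edges of G
  Var : Set
  Var = Fin n ⊎ Fin m

  _≟ᵛ_ : DecidableEquality Var
  _≟ᵛ_ = ≡-dec _≟ᶠ_ _≟ᶠ_

  -- the variables of the clause (u ∨ e ∨ v) of edge e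
  InClause : Fin m → Var → Set
  InClause e x = (x ≡ inj₁ (proj₁ (ends e))) ⊎ (x ≡ inj₂ e) ⊎ (x ≡ inj₁ (proj₂ (ends e)))

data Lit (V : Set) : Set where
  pos : V → Lit V
  neg : V → Lit V

litVar : ∀ {V} → Lit V → V
litVar (pos x) = x
litVar (neg x) = x

open import Data.Bool using (Bool; true; false; not; T)

TrueLit : ∀ {V} → (V → Bool) → Lit V → Set
TrueLit σ (pos x) = T (σ x)
TrueLit σ (neg x) = T (not (σ x))

record NBP (V : Set) : Set where
  field
    N : ℕ
    M : ℕ
    src tgt : Fin M → Fin N
    label   : Fin M → Maybe (Lit V)
    source sink : Fin N

module _ {V : Set} (Z : NBP V) where
  open NBP Z

  data IsPath : Fin N → Fin N → List (Fin M) → Set where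
    nil  : ∀ {x} → IsPath x x []
    cons : ∀ {y es} e → IsPath (tgt e) y es → IsPath (src e) y (e ∷ es)

  labels : List (Fin M) → List (Lit V)
  labels = mapMaybe label

  vars : List (Fin M) → List V
  vars es = Data.List.map litVar (labels es)
    where import Data.List

  record WellFormed : Set where
    field
      acyclic : ∀ v e es → ¬ IsPath v v (e ∷ es)
      sourceUnique : ∀ v → ((∀ e → tgt e ≢ v) → v ≡ source) × (v ≡ source → ∀ e → tgt e ≢ v)
      sinkUnique   : ∀ v → ((∀ e → src e ≢ v) → v ≡ sink) × (v ≡ sink → ∀ e → src e ≢ v)

  Consistent : List (Fin M) → Set
  Consistent es = ∀ x → Any (_≡ pos x) (labels es) → Any (_≡ neg x) (labels es) → ⊥

  LabelsTrue : (V → Bool) → List (Fin M) → Set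
  LabelsTrue σ es = ∀ l → Any (_≡ l) (labels es) → TrueLit σ l

  SatisfiesNBP : (V → Bool) → Set
  SatisfiesNBP σ = ∃[ es ] (IsPath source sink es × Consistent es × LabelsTrue σ es)

  Monotone : Set
  Monotone = ∀ e x → label e ≢ just (neg x)

  ReadOnce : List (Fin M) → Set
  ReadOnce es = Unique (vars es)

  record SMNBP (_≟_ : DecidableEquality V) (d : ℕ) : Set where
    field
      wf       : WellFormed
      monotone : Monotone
      atMostD  : ∀ x y es → IsPath x y es → ∀ v →
                 length (filter (_≟ v) (vars es)) ≤ d
      partition : ∀ es → IsPath source sink es →
                  ∃[ ps ] (concat ps ≡ es × length ps ≤ d ×
                           All ReadOnce ps)

  record Yardsticks (d : ℕ) (es : List (Fin M)) : Set where
    field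
      a    : ℕ
      a≤d  : a ≤ d
      us   : Fin (suc a) → Fin N
      segs : Fin a → List (Fin M)
      first : us Data.Fin.zero ≡ source
      last  : us (fromℕ a) ≡ sink
      segPath : ∀ i → IsPath (us (inject₁ i)) (us (Data.Fin.suc i)) (segs i)
      split   : concat (tabulate segs) ≡ es
      readOnce : ∀ i qs → IsPath (us (inject₁ i)) (us (Data.Fin.suc i)) qs → ReadOnce qs

  HasYardsticks : ℕ → Set
  HasYardsticks d = ∀ es → IsPath source sink es → Yardsticks d es

module _ (G : Graph) where
  open Graph G

  SatisfiesPsi : (Var G → Bool) → Set
  SatisfiesPsi σ = ∀ e → ∃[ x ] (InClause G e x × T (σ x))

  Represents : NBP (Var G) → Set
  Represents Z = ∀ σ → (SatisfiesNBP Z σ → SatisfiesPsi σ) × (SatisfiesPsi σ → SatisfiesNBP Z σ)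

  module _ (Z : NBP (Var G)) where
    open NBP Z using (N; M)

    InPsiXY : Fin N → Fin N → Fin m → Set
    InPsiXY x y e = ∀ es → IsPath Z x y es →
                    Any (λ l → InClause G e (litVar l)) (labels Z es)

    GXY : Fin N → Fin N → Subgraph G
    GXY x y = record
      { V = λ v → ∃[ e ] (InPsiXY x y e × IsEnd G v e)
      ; E = InPsiXY x y
      ; closed = λ e v p q → e , p , q
      }

{-# OPTIONS --safe #-}

-- Every clause C_e of ψ(G) lies in ψ(u_i, u_{i+1}) for some segment of the yardsticks:
-- otherwise gluing paths that avoid C_e on every segment gives a source–sink path, and
-- setting exactly its variables true satisfies the monotone program Z but falsifies C_e.
-- So the graphs G(u_i, u_{i+1}), padded with empty graphs to d pieces, cover G (which has
-- no isolated vertices), and d-pw(G) ≥ k forces one of them to have pathwidth ≥ k.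
-- Choosing that piece constructively needs "pathwidth ≤ k − 1" to be decidable: ψ(x, y)
-- only depends on paths of length at most |V(Z)| since Z is acyclic, and a path
-- decomposition can be shrunk to at most |V(G)| + |E(G)| bags.

module Submission where

open import Defs
open import Data.Bool using (Bool)
open import Data.Nat using (ℕ; zero; suc; _+_; _≤_; _<_; z≤n; s≤s)
import Data.Nat.Properties as ℕ
open import Data.Fin using (Fin; zero; suc; inject₁; inject≤; fromℕ; splitAt; _↑ˡ_; _↑ʳ_)
  renaming (_≤_ to _≤ᶠ_)
open import Data.Fin.Properties
  using (any?; all?; injective⇒≤; inject≤-injective; splitAt-↑ˡ; splitAt-↑ʳ; suc-injective)
  renaming (_≟_ to _≟ᶠ_; _≤?_ to _≤ᶠ?_)
open import Data.Fin.Subset using (Subset; _∈_; ∣_∣)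
open import Data.Fin.Subset.Properties using (_∈?_; anySubset?)
open import Data.Vec using (Vec; []; _∷_; lookup; tabulate)
open import Data.Vec.Properties using (lookup∘tabulate)
open import Data.List using (List; []; _∷_; _++_; length)
open import Data.List.Properties using (mapMaybe-++)
open import Data.List.Relation.Unary.All using (All)
import Data.List.Relation.Unary.All as All
import Data.List.Relation.Unary.All.Properties as Allₚ
open import Data.List.Relation.Unary.Any using (Any)
import Data.List.Relation.Unary.Any as Any
import Data.List.Relation.Unary.Any.Properties as Anyₚ
open import Data.Maybe using (Maybe; just; nothing)
import Data.Maybe.Relation.Unary.All as Maybe
open import Data.Maybe.Properties using (just-injective) renaming (≡-dec to ≡-decᵐ)
open import Data.Product using (Σ-syntax; ∃; ∃-syntax; _×_; _,_; proj₁; proj₂)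
open import Data.Sum using (_⊎_; inj₁; inj₂; [_,_]′)
open import Data.Empty using (⊥-elim)
open import Function using (_∘_)
open import Function.Definitions using (Injective)
open import Relation.Nullary using (¬_; Dec; yes; no)
open import Relation.Nullary.Decidable
  using (isYes; decidable-stable; toWitness; fromWitness; _×-dec_; _⊎-dec_; _→-dec_; ¬?)
open import Relation.Unary using (Decidable)
open import Relation.Binary.Definitions using (DecidableEquality)
open import Relation.Binary.PropositionalEquality
  using (_≡_; refl; sym; trans; cong; subst; subst₂; module ≡-Reasoning)

Searchable : Set → Set₁
Searchable A = ∀ {P : A → Set} → Decidable P → Dec (∃ P)

anyVec? : ∀ {A} → Searchable A → ∀ r → Searchable (Vec A r)
anyVec? search zero P? with P? []
... | yes p = yes ([] , p)
... | no ¬p = no λ { ([] , p) → ¬p p }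
anyVec? search (suc r) P? with search (λ x → anyVec? search r (λ xs → P? (x ∷ xs)))
... | yes (x , xs , p) = yes (x ∷ xs , p)
... | no ¬p = no λ { (x ∷ xs , p) → ¬p (x , xs , p) }

anyList≤? : ∀ {A} → Searchable A → ∀ L {P : List A → Set} → Decidable P →
            Dec (∃[ xs ] (length xs ≤ L × P xs))
anyList≤? search zero P? with P? []
... | yes p = yes ([] , z≤n , p)
... | no ¬p = no λ { ([] , _ , p) → ¬p p ; (_ ∷ _ , () , _) }
anyList≤? search (suc L) P? with P? [] | search (λ x → anyList≤? search L (λ xs → P? (x ∷ xs)))
... | yes p | _ = yes ([] , z≤n , p)
... | no _  | yes (x , xs , len≤ , p) = yes (x ∷ xs , s≤s len≤ , p)
... | no ¬p | no ¬q =
  no λ { ([] , _ , p) → ¬p p ; (x ∷ xs , s≤s len≤ , p) → ¬q (x , xs , len≤ , p) }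

IsPositive : ∀ {V} → Lit V → Set
IsPositive l = ∃[ x ] l ≡ pos x

module _ {V : Set} (Z : NBP V) where
  open NBP Z

  ++-isPath : ∀ {x y z p q} → IsPath Z x y p → IsPath Z y z q → IsPath Z x z (p ++ q)
  ++-isPath nil q = q
  ++-isPath (cons e p) q = cons e (++-isPath p q)

  isPath? : ∀ x y es → Dec (IsPath Z x y es)
  isPath? x y [] with x ≟ᶠ y
  ... | yes refl = yes nil
  ... | no x≢y = no λ { nil → x≢y refl }
  isPath? x y (e ∷ es) with src e ≟ᶠ x | isPath? (tgt e) y es
  ... | yes refl | yes p = yes (cons e p)
  ... | no src≢x | _ = no λ { (cons .e p) → src≢x refl }
  ... | yes refl | no ¬p = no λ { (cons .e p) → ¬p p }

  vertexAt : ∀ {x y es} → IsPath Z x y es → Fin (suc (length es)) → Fin N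
  vertexAt {x} p zero = x
  vertexAt (cons e p) (suc i) = vertexAt p i

  pathTo-vertexAt : ∀ {x y es} (p : IsPath Z x y es) i → ∃[ qs ] IsPath Z x (vertexAt p i) qs
  pathTo-vertexAt p zero = [] , nil
  pathTo-vertexAt (cons e p) (suc i) with pathTo-vertexAt p i
  ... | qs , q = e ∷ qs , cons e q

  module _ (wf : WellFormed Z) where
    open WellFormed wf

    vertexAt-injective : ∀ {x y es} (p : IsPath Z x y es) → Injective _≡_ _≡_ (vertexAt p)
    vertexAt-injective p {zero} {zero} _ = refl
    vertexAt-injective (cons e p) {zero} {suc j} src≡ with pathTo-vertexAt p j
    ... | qs , q =
      ⊥-elim (acyclic _ e qs (cons e (subst (λ v → IsPath Z (tgt e) v qs) (sym src≡) q)))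
    vertexAt-injective (cons e p) {suc i} {zero} ≡src with pathTo-vertexAt p i
    ... | qs , q =
      ⊥-elim (acyclic _ e qs (cons e (subst (λ v → IsPath Z (tgt e) v qs) ≡src q)))
    vertexAt-injective (cons e p) {suc i} {suc j} eq = cong suc (vertexAt-injective p eq)

    length≤N : ∀ {x y es} → IsPath Z x y es → length es ≤ N
    length≤N p = ℕ.≤-trans (ℕ.n≤1+n _) (injective⇒≤ (vertexAt-injective p))

  concatPaths : ∀ {a} (us : Fin (suc a) → Fin N) (Q : List (Fin M) → Set) →
                Q [] → (∀ p q → Q p → Q q → Q (p ++ q)) →
                (∀ i → ∃[ es ] (IsPath Z (us (inject₁ i)) (us (suc i)) es × Q es)) →
                ∃[ es ] (IsPath Z (us zero) (us (fromℕ a)) es × Q es)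
  concatPaths {zero} us Q Q[] Q++ segment = [] , nil , Q[]
  concatPaths {suc a} us Q Q[] Q++ segment
    with segment zero | concatPaths (us ∘ suc) Q Q[] Q++ (segment ∘ suc)
  ... | es , p , q | es′ , p′ , q′ = es ++ es′ , ++-isPath p p′ , Q++ es es′ q q′

  Any-labels-++⁻ : ∀ {P : Lit V → Set} p q →
                   Any P (labels Z (p ++ q)) → Any P (labels Z p) ⊎ Any P (labels Z q)
  Any-labels-++⁻ p q = Anyₚ.++⁻ (labels Z p) ∘ subst (Any _) (mapMaybe-++ label p q)

  module _ (mono : Monotone Z) where

    labels-positive : ∀ es → All IsPositive (labels Z es)
    labels-positive es = Allₚ.mapMaybe⁺ (Allₚ.map⁺ (All.universal positive es))
      where
      positive : ∀ f → Maybe.All IsPositive (label f)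
      positive f with label f in eq
      ... | nothing = Maybe.nothing
      ... | just (pos x) = Maybe.just (x , refl)
      ... | just (neg x) = ⊥-elim (mono f x eq)

    ¬Any-neg-labels : ∀ {x} es → ¬ Any (_≡ neg x) (labels Z es)
    ¬Any-neg-labels es = All.lookupWith (λ { (_ , refl) () }) (labels-positive es)

    module _ (_≟_ : DecidableEquality V) where

      onVars : List (Fin M) → V → Bool
      onVars es x = isYes (Any.any? (_≟ x) (vars Z es))

      satisfies-onVars : ∀ {es} → IsPath Z source sink es → SatisfiesNBP Z (onVars es)
      satisfies-onVars {es} p = es , p , (λ _ _ → ¬Any-neg-labels es) , labelsTrue
        where
        labelsTrue : LabelsTrue Z (onVars es) es
        labelsTrue (pos x) x∈ = fromWitness (Anyₚ.map⁺ (Any.map (cong litVar) x∈))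
        labelsTrue (neg x) x∈ = ⊥-elim (¬Any-neg-labels es x∈)

record Enumeration {r} (P : Fin r → Set) : Set where
  field
    size         : ℕ
    at           : Fin size → Fin r
    at-mono      : ∀ {i j} → i ≤ᶠ j → at i ≤ᶠ at j
    at-injective : Injective _≡_ _≡_ at
    at-sound     : ∀ j → P (at j)
    at-complete  : ∀ i → P i → ∃[ j ] at j ≡ i

module _ {r} {P : Fin (suc r) → Set} (E : Enumeration (P ∘ suc)) where
  open Enumeration E

  Enumeration-skipZero : ¬ P zero → Enumeration P
  Enumeration-skipZero ¬p = record
    { size = size
    ; at = suc ∘ at
    ; at-mono = s≤s ∘ at-mono
    ; at-injective = at-injective ∘ suc-injective
    ; at-sound = at-sound
    ; at-complete = λ { zero p → ⊥-elim (¬p p)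
                      ; (suc i) p → let j , at≡ = at-complete i p in j , cong suc at≡ }
    }

  Enumeration-keepZero : P zero → Enumeration P
  Enumeration-keepZero p = record
    { size = suc size
    ; at = at′
    ; at-mono = mono
    ; at-injective = injective
    ; at-sound = λ { zero → p ; (suc j) → at-sound j }
    ; at-complete = λ { zero _ → zero , refl
                      ; (suc i) p → let j , at≡ = at-complete i p in suc j , cong suc at≡ }
    }
    where
    at′ : Fin (suc size) → Fin (suc r)
    at′ zero = zero
    at′ (suc j) = suc (at j)

    mono : ∀ {i j} → i ≤ᶠ j → at′ i ≤ᶠ at′ j
    mono {zero} _ = z≤n
    mono {suc _} {suc _} (s≤s i≤j) = s≤s (at-mono i≤j)

    injective : Injective _≡_ _≡_ at′
    injective {zero} {zero} _ = refl
    injective {suc _} {suc _} eq = cong suc (at-injective (suc-injective eq))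

enumerate : ∀ {r} {P : Fin r → Set} → Decidable P → Enumeration P
enumerate {zero} P? = record
  { size = 0 ; at = λ () ; at-mono = λ {} ; at-injective = λ {}
  ; at-sound = λ () ; at-complete = λ () }
enumerate {suc r} P? with P? zero
... | yes p = Enumeration-keepZero (enumerate (P? ∘ suc)) p
... | no ¬p = Enumeration-skipZero (enumerate (P? ∘ suc)) ¬p

module _ (G : Graph) where
  open Graph G

  widen : ∀ {H w w′} → w ≤ w′ → PathDecomposition G H w → PathDecomposition G H w′
  widen w≤w′ D = record
    { r = r ; B = B ; bags⊆V = bags⊆V ; vcover = vcover ; ecover = ecover ; interval = interval
    ; width = λ i → ℕ.≤-trans (width i) (s≤s w≤w′) }
    where open PathDecomposition D

  pwAtLeast-suc : ∀ {H w} → ¬ PwAtMost G H w → PwAtLeast G H (suc w)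
  pwAtLeast-suc {w = w} ¬pw w′ D with w′ ℕ.≤? w
  ... | yes w′≤w = ⊥-elim (¬pw (widen w′≤w D))
  ... | no w′≰w = ℕ.≰⇒> w′≰w

  module _ (H : Subgraph G) (w : ℕ) where
    open Subgraph H

    IsPathDecomposition : ∀ {r} → (Fin r → Subset n) → Set
    IsPathDecomposition {r} B =
      (∀ i v → v ∈ B i → V v) ×
      (∀ v → V v → ∃[ i ] v ∈ B i) ×
      (∀ e → E e → ∃[ i ] (proj₁ (ends e) ∈ B i × proj₂ (ends e) ∈ B i)) ×
      (∀ v (i j l : Fin r) → i ≤ᶠ j → j ≤ᶠ l → v ∈ B i → v ∈ B l → v ∈ B j) ×
      (∀ i → ∣ B i ∣ ≤ suc w)

    toPathDecomposition : ∀ {r} {B : Fin r → Subset n} →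
                          IsPathDecomposition B → PathDecomposition G H w
    toPathDecomposition {r} {B} (bags⊆V , vcover , ecover , interval , width) =
      record { r = r ; B = B ; bags⊆V = bags⊆V ; vcover = vcover ; ecover = ecover
             ; interval = interval ; width = width }

    fromPathDecomposition : (D : PathDecomposition G H w) →
                            IsPathDecomposition (PathDecomposition.B D)
    fromPathDecomposition D = bags⊆V , vcover , ecover , interval , width
      where open PathDecomposition D

    IsPathDecomposition-resp : ∀ {r} {B B′ : Fin r → Subset n} →
                               (∀ i → B i ≡ B′ i) →
                               IsPathDecomposition B → IsPathDecomposition B′
    IsPathDecomposition-resp {B = B} {B′} B≡B′ (bags⊆V , vcover , ecover , interval , width) =
      (λ i v → bags⊆V i v ∘ from) ,
      (λ v v∈ → let i , v∈B = vcover v v∈ in i , to v∈B) ,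
      (λ e e∈ → let i , x∈B , y∈B = ecover e e∈ in i , to x∈B , to y∈B) ,
      (λ v i j l i≤j j≤l v∈i v∈l → to (interval v i j l i≤j j≤l (from v∈i) (from v∈l))) ,
      (λ i → subst (λ X → ∣ X ∣ ≤ suc w) (B≡B′ i) (width i))
      where
      to : ∀ {v i} → v ∈ B i → v ∈ B′ i
      to {v} {i} = subst (v ∈_) (B≡B′ i)
      from : ∀ {v i} → v ∈ B′ i → v ∈ B i
      from {v} {i} = subst (v ∈_) (sym (B≡B′ i))

    module _ (V? : Decidable V) (E? : Decidable E) where

      isPathDecomposition? : ∀ {r} (B : Fin r → Subset n) → Dec (IsPathDecomposition B)
      isPathDecomposition? B =
        all? (λ i → all? λ v → (v ∈? B i) →-dec V? v) ×-dec
        (all? (λ v → V? v →-dec any? λ i → v ∈? B i) ×-dec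
        (all? (λ e → E? e →-dec any? λ i →
                       (proj₁ (ends e) ∈? B i) ×-dec (proj₂ (ends e) ∈? B i)) ×-dec
        (all? (λ v → all? λ i → all? λ j → all? λ l → (i ≤ᶠ? j) →-dec ((j ≤ᶠ? l) →-dec
           ((v ∈? B i) →-dec ((v ∈? B l) →-dec (v ∈? B j))))) ×-dec
        all? (λ i → ∣ B i ∣ ℕ.≤? suc w))))

      -- Keep only the bags chosen as witnesses for vertices and edges, in their original order;
      -- the interval property survives because the kept bags are a subsequence.
      compress : PathDecomposition G H w →
                 Σ[ D ∈ PathDecomposition G H w ] PathDecomposition.r D ≤ n + m
      compress D = D′ , injective⇒≤ witness-injective
        where
        open PathDecomposition D

        vertexBag : Fin n → Maybe (Fin r)
        vertexBag v with V? v
        ... | yes v∈ = just (proj₁ (vcover v v∈))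
        ... | no _ = nothing

        edgeBag : Fin m → Maybe (Fin r)
        edgeBag e with E? e
        ... | yes e∈ = just (proj₁ (ecover e e∈))
        ... | no _ = nothing

        chosenBag : Fin (n + m) → Maybe (Fin r)
        chosenBag = [ vertexBag , edgeBag ]′ ∘ splitAt n

        vertex-chosen : ∀ v → V v → ∃[ i ] (chosenBag (v ↑ˡ m) ≡ just i × v ∈ B i)
        vertex-chosen v v∈ rewrite splitAt-↑ˡ n v m with V? v
        ... | yes v∈′ = _ , refl , proj₂ (vcover v v∈′)
        ... | no v∉ = ⊥-elim (v∉ v∈)

        edge-chosen : ∀ e → E e → ∃[ i ] (chosenBag (n ↑ʳ e) ≡ just i ×
                                           proj₁ (ends e) ∈ B i × proj₂ (ends e) ∈ B i)
        edge-chosen e e∈ rewrite splitAt-↑ʳ n m e with E? e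
        ... | yes e∈′ = _ , refl , proj₂ (ecover e e∈′)
        ... | no e∉ = ⊥-elim (e∉ e∈)

        open Enumeration (enumerate (λ i → any? λ x → ≡-decᵐ _≟ᶠ_ (chosenBag x) (just i)))

        witness-injective : Injective _≡_ _≡_ (proj₁ ∘ at-sound)
        witness-injective {j} {j′} eq = at-injective (just-injective (begin
          just (at j)                      ≡⟨ sym (proj₂ (at-sound j)) ⟩
          chosenBag (proj₁ (at-sound j))   ≡⟨ cong chosenBag eq ⟩
          chosenBag (proj₁ (at-sound j′))  ≡⟨ proj₂ (at-sound j′) ⟩
          just (at j′)                     ∎))
          where open ≡-Reasoning

        D′ : PathDecomposition G H w
        D′ = record
          { r = size
          ; B = B ∘ at
          ; bags⊆V = bags⊆V ∘ at
          ; vcover = λ v v∈ →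
              let i , chosen , v∈B = vertex-chosen v v∈
                  j , at≡ = at-complete i (_ , chosen)
              in j , subst (λ i → v ∈ B i) (sym at≡) v∈B
          ; ecover = λ e e∈ →
              let i , chosen , x∈B , y∈B = edge-chosen e e∈
                  j , at≡ = at-complete i (_ , chosen)
              in j , subst (λ i → _ ∈ B i) (sym at≡) x∈B , subst (λ i → _ ∈ B i) (sym at≡) y∈B
          ; interval = λ v i j l i≤j j≤l →
              interval v (at i) (at j) (at l) (at-mono i≤j) (at-mono j≤l)
          ; width = width ∘ at
          }

      pwAtMost? : Dec (PwAtMost G H w)
      pwAtMost?
        with ℕ.anyUpTo? (λ r → anyVec? anySubset? r (isPathDecomposition? ∘ lookup)) (suc (n + m))
      ... | yes (_ , _ , _ , isPD) = yes (toPathDecomposition isPD)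
      ... | no none = no (none ∘ bagVector ∘ compress)
        where
        bagVector : Σ[ D ∈ PathDecomposition G H w ] PathDecomposition.r D ≤ n + m →
                    ∃[ r ] (r < suc (n + m) ×
                            Σ[ Bs ∈ Vec (Subset n) r ] IsPathDecomposition (lookup Bs))
        bagVector (D , r≤) =
          r , s≤s r≤ , tabulate B ,
          IsPathDecomposition-resp (sym ∘ lookup∘tabulate B) (fromPathDecomposition D)
          where open PathDecomposition D

  module _ {a d} (H : Fin a → Subgraph G) (f : Fin a → Fin d) where

    image : Fin d → Subgraph G
    image j = record
      { V = λ v → ∃[ i ] (f i ≡ j × Subgraph.V (H i) v)
      ; E = λ e → ∃[ i ] (f i ≡ j × Subgraph.E (H i) e)
      ; closed = λ { e v (i , fi≡j , e∈) v∈e → i , fi≡j , Subgraph.closed (H i) e v e∈ v∈e }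
      }

    image-pwAtMost : Injective _≡_ _≡_ f → ∀ {w} →
                     (∀ i → PwAtMost G (H i) w) → ∀ j → PwAtMost G (image j) w
    image-pwAtMost f-injective pw j with any? (λ i → f i ≟ᶠ j)
    ... | yes (i₀ , fi₀≡j) = record
      { r = r ; B = B
      ; bags⊆V = λ i v v∈ → i₀ , fi₀≡j , bags⊆V i v v∈
      ; vcover = λ { v (i , fi≡j , v∈) →
                       vcover v (subst (λ i → Subgraph.V (H i) v) (≡i₀ fi≡j) v∈) }
      ; ecover = λ { e (i , fi≡j , e∈) →
                       ecover e (subst (λ i → Subgraph.E (H i) e) (≡i₀ fi≡j) e∈) }
      ; interval = interval ; width = width
      }
      where
      open PathDecomposition (pw i₀)
      ≡i₀ : ∀ {i} → f i ≡ j → i ≡ i₀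
      ≡i₀ fi≡j = f-injective (trans fi≡j (sym fi₀≡j))
    ... | no ∄ = record
      { r = 0 ; B = λ ()
      ; bags⊆V = λ ()
      ; vcover = λ { v (i , fi≡j , _) → ⊥-elim (∄ (i , fi≡j)) }
      ; ecover = λ { e (i , fi≡j , _) → ⊥-elim (∄ (i , fi≡j)) }
      ; interval = λ _ ()
      ; width = λ ()
      }

  module _ {d k} (noIsolated : NoIsolatedVertices G) (dpw : DPwAtLeast G d k) where

    DPwAtLeast-cover-≤ : ∀ {a w} → a ≤ d → (H : Fin a → Subgraph G) →
                       (∀ e → ∃[ i ] Subgraph.E (H i) e) → (∀ i → PwAtMost G (H i) w) → k ≤ w
    DPwAtLeast-cover-≤ a≤d H covers pw =
      dpw _ (image H ι) (image-pwAtMost H ι ι-injective pw) vcover ecover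
      where
      ι = λ i → inject≤ i a≤d
      ι-injective : Injective _≡_ _≡_ ι
      ι-injective = inject≤-injective a≤d a≤d _ _
      ecover : ∀ e → ∃[ j ] Subgraph.E (image H ι j) e
      ecover e = let i , e∈ = covers e in ι i , i , refl , e∈
      vcover : ∀ v → ∃[ j ] Subgraph.V (image H ι j) v
      vcover v = let e , v∈e = noIsolated v ; i , e∈ = covers e in
                 ι i , i , refl , Subgraph.closed (H i) e v e∈ v∈e

  DPwAtLeast-cover-piece : ∀ {a d k} → a ≤ d → NoIsolatedVertices G → DPwAtLeast G d (suc k) →
                   (H : Fin a → Subgraph G) → (∀ e → ∃[ i ] Subgraph.E (H i) e) →
                   (∀ i → Dec (PwAtMost G (H i) k)) → ∃[ i ] PwAtLeast G (H i) (suc k)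
  DPwAtLeast-cover-piece a≤d noIsolated dpw H covers pw? with any? (¬? ∘ pw?)
  ... | yes (i , ¬pw) = i , pwAtLeast-suc ¬pw
  ... | no ∄ = ⊥-elim (ℕ.1+n≰n (DPwAtLeast-cover-≤ noIsolated dpw a≤d H covers pw))
    where
    pw : ∀ i → PwAtMost G (H i) _
    pw i = decidable-stable (pw? i) (∄ ∘ (i ,_))

module _ (G : Graph) (Z : NBP (Var G)) where
  open Graph G
  open NBP Z

  Hits : Fin m → List (Fin M) → Set
  Hits e es = Any (λ l → InClause G e (litVar l)) (labels Z es)

  inClause? : ∀ e → Decidable (InClause G e)
  inClause? e x = (_≟ᵛ_ G x _) ⊎-dec ((_≟ᵛ_ G x _) ⊎-dec (_≟ᵛ_ G x _))

  hits? : ∀ e → Decidable (Hits e)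
  hits? e es = Any.any? (inClause? e ∘ litVar) (labels Z es)

  ¬Hits-++ : ∀ {e} p q → ¬ Hits e p → ¬ Hits e q → ¬ Hits e (p ++ q)
  ¬Hits-++ p q ¬hp ¬hq = [ ¬hp , ¬hq ]′ ∘ Any-labels-++⁻ Z p q

  sourceSinkPath-hits : Monotone Z → Represents G Z →
                        ∀ e {es} → IsPath Z source sink es → Hits e es
  sourceSinkPath-hits mono rep e {es} p
    with proj₁ (rep (onVars Z mono (_≟ᵛ_ G) es)) (satisfies-onVars Z mono (_≟ᵛ_ G) p) e
  ... | x , x∈e , x∈es =
    Any.map (λ x≡ → subst (InClause G e) (sym x≡) x∈e) (Anyₚ.map⁻ (toWitness x∈es))

  module _ (wf : WellFormed Z) where

    inPsiXY-or-avoidingPath : ∀ x y e →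
                              InPsiXY G Z x y e ⊎ ∃[ es ] (IsPath Z x y es × ¬ Hits e es)
    inPsiXY-or-avoidingPath x y e
      with anyList≤? any? N (λ es → isPath? Z x y es ×-dec ¬? (hits? e es))
    ... | yes (es , _ , p , ¬h) = inj₂ (es , p , ¬h)
    ... | no none = inj₁ λ es p →
      decidable-stable (hits? e es) λ ¬h → none (es , length≤N Z wf p , p , ¬h)

    inPsiXY? : ∀ x y → Decidable (InPsiXY G Z x y)
    inPsiXY? x y e with inPsiXY-or-avoidingPath x y e
    ... | inj₁ ψ = yes ψ
    ... | inj₂ (es , p , ¬h) = no λ ψ → ¬h (ψ es p)

    avoidingPath : ∀ x y e → ¬ InPsiXY G Z x y e → ∃[ es ] (IsPath Z x y es × ¬ Hits e es)
    avoidingPath x y e ∉ψ with inPsiXY-or-avoidingPath x y e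
    ... | inj₁ ψ = ⊥-elim (∉ψ ψ)
    ... | inj₂ path = path

    GXY-V? : ∀ x y → Decidable (Subgraph.V (GXY G Z x y))
    GXY-V? x y v = any? λ e → inPsiXY? x y e ×-dec ((v ≟ᶠ _) ⊎-dec (v ≟ᶠ _))

    GXY-pwAtMost? : ∀ x y w → Dec (PwAtMost G (GXY G Z x y) w)
    GXY-pwAtMost? x y w = pwAtMost? G (GXY G Z x y) w (GXY-V? x y) (inPsiXY? x y)

    -- If every segment had a path avoiding the clause of e, their concatenation would be
    -- a source–sink path avoiding it.
    clause-in-some-segment : Monotone Z → Represents G Z →
                             ∀ {a} (us : Fin (suc a) → Fin N) →
                             us zero ≡ source → us (fromℕ a) ≡ sink →
                             ∀ e → ∃[ i ] InPsiXY G Z (us (inject₁ i)) (us (suc i)) e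
    clause-in-some-segment mono rep us first last e with any? (λ i → inPsiXY? _ _ e)
    ... | yes found = found
    ... | no ∄ with concatPaths Z us (¬_ ∘ Hits e) (λ ()) ¬Hits-++
                      (λ i → avoidingPath _ _ e (∄ ∘ (i ,_)))
    ... | es , p , ¬hits =
      ⊥-elim (¬hits (sourceSinkPath-hits mono rep e
                       (subst₂ (λ x y → IsPath Z x y es) first last p)))

lemma1 : (d k : ℕ) → 1 ≤ d → 1 ≤ k →
    (G : Graph) → NoIsolatedVertices G → DPwAtLeast G d k →
    (Z : NBP (Var G)) → SMNBP Z (_≟ᵛ_ G) d → HasYardsticks Z d → Represents G Z →
    (P : List (Fin (NBP.M Z))) → IsPath Z (NBP.source Z) (NBP.sink Z) P →
    (Y : Yardsticks Z d P) →
    ∃[ i ] PwAtLeast G (GXY G Z (Yardsticks.us Y (inject₁ i)) (Yardsticks.us Y (suc i))) k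
lemma1 d .(suc k) _ (s≤s {n = k} z≤n) G noIsolated dpw Z smnbp _ rep _ _ Y =
  DPwAtLeast-cover-piece G a≤d noIsolated dpw segment
    (clause-in-some-segment G Z wf monotone rep us first last)
    (λ i → GXY-pwAtMost? G Z wf _ _ k)
  where
  open Yardsticks Y
  open SMNBP smnbp
  segment : Fin a → Subgraph G
  segment i = GXY G Z (us (inject₁ i)) (us (suc i))
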